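{- Given a network $N$ and a formula $\phi\in\Phi(N)$, it is decidable whether $\vdash_N\phi$.
   Context: A network $N$ is a finite undirected graph (loops and multiple edges allowed) whose vertices are parties and whose edges, called channels, are labeled by secret variables; sets of channels are identified with sets of labels. $\Phi(N)$ is the smallest set of formulas containing $A\rhd B$ for finite sets of channels $A,B$, the constant $\bot$, and closed under $\to$. A path is a sequence of channels forming an undirected walk; a set $G$ of channels is a gateway between sets $A$ and $B$ if every path whose first channel is in $A$ and last channel is in $B$ contains a channel of $G$. The Logic of Secrets for $N$ consists of all propositional tautologies, the Modus Ponens rule, and the axioms Reflexivity ($A\rhd B$ if $A\supseteq B$), Augmentation ($A\rhd B\to A\cup C\rhd B\cup C$), Transitivity ($A\rhd B\to(B\rhd C\to A\rhd C)$), Gateway ($A\rhd B\to G\rhd B$ if $G$ is a gateway between $A$ and $B$ in $N$). $\vdash_N\phi$ means $\phi$ is derivable in this system. -}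

module Defs where

open import Data.Nat using (ℕ)
open import Data.Fin using (Fin)
open import Data.Fin.Subset using (Subset; _∈_; _⊆_; _∪_)
open import Data.Bool using (Bool; true; false; _∧_; _∨_; not)
open import Data.Product using (_×_; _,_)
open import Data.Sum using (_⊎_)
open import Data.List.NonEmpty using (List⁺; _∷_; _∷⁺_; head; last; toList)
open import Data.List using ([])
open import Data.List.Relation.Unary.Any using (Any)
open import Relation.Binary.PropositionalEquality using (_≡_)

-- Channel c : Fin channels has endpoints  ends c  (an unordered
-- edge; loops  u = v  and parallel channels are allowed).  Channels are
-- identified with their (distinct) secret-variable labels.
record Network : Set where
  field
    parties  : ℕ
    channels : ℕ
    ends     : Fin channels → Fin parties × Fin parties
open Network public

ChSet : Network → Set
ChSet N = Subset (channels N)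

Link : (N : Network) → Fin (channels N) → Fin (parties N) → Fin (parties N) → Set
Link N c u v = (ends N c ≡ (u , v)) ⊎ (ends N c ≡ (v , u))

data Walk (N : Network) : Fin (parties N) → Fin (parties N) → List⁺ (Fin (channels N)) → Set where
  one  : ∀ {c u v} → Link N c u v → Walk N u v (c ∷ [])
  cons : ∀ {c u v w cs} → Link N c u v → Walk N v w cs → Walk N u w (c ∷⁺ cs)


Gateway : (N : Network) → ChSet N → ChSet N → ChSet N → Set
Gateway N G A B =
  ∀ {u v} (cs : List⁺ (Fin (channels N))) → Walk N u v cs →
  head cs ∈ A → last cs ∈ B → Any (λ c → c ∈ G) (toList cs)

infixr 5 _⇒_
infix 6 _▷_
data Formula (N : Network) : Set where
  _▷_ : ChSet N → ChSet N → Formula N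
  ⊥′  : Formula N
  _⇒_ : Formula N → Formula N → Formula N

eval : {N : Network} → (ChSet N → ChSet N → Bool) → Formula N → Bool
eval val (A ▷ B) = val A B
eval val ⊥′ = false
eval val (φ ⇒ ψ) = not (eval val φ) ∨ eval val ψ

Tautology : {N : Network} → Formula N → Set
Tautology {N} φ = ∀ (val : ChSet N → ChSet N → Bool) → eval val φ ≡ true

infix 2 _⊢_
data _⊢_ (N : Network) : Formula N → Set where
  taut         : ∀ {φ} → Tautology φ → N ⊢ φ
  mp           : ∀ {φ ψ} → N ⊢ (φ ⇒ ψ) → N ⊢ φ → N ⊢ ψ
  reflexivity  : ∀ {A B} → B ⊆ A → N ⊢ A ▷ B
  augmentation : ∀ {A B C} → N ⊢ (A ▷ B ⇒ (A ∪ C) ▷ (B ∪ C))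
  transitivity : ∀ {A B C} → N ⊢ (A ▷ B ⇒ (B ▷ C ⇒ A ▷ C))
  gateway      : ∀ {A B G} → Gateway N G A B → N ⊢ (A ▷ B ⇒ G ▷ B)

-- The only non-propositional ingredients of the calculus are its four axiom
-- schemes, and over a fixed network N they have only finitely many
-- instances: there are finitely many sets of channels, and the side
-- conditions "B ⊆ A" and "G is a gateway between A and B" are decidable.
-- Hence N ⊢ φ holds iff the single formula  γ₁ ⇒ … ⇒ γₖ ⇒ φ  is a
-- propositional tautology, where γ₁ … γₖ list all axiom instances; and
-- being a tautology is decidable because a formula only depends on the
-- finitely many atoms occurring in it.

module Submission where

open import Defs
open import Relation.Nullary using (Dec; yes; no; ¬_; does)

open import Level using (0ℓ)
open import Function using (_∘_; id)
open import Data.Nat using (ℕ; zero; suc)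
open import Data.Bool using (Bool; true; false; not; _∨_; if_then_else_)
import Data.Bool as Bool
open import Data.Fin using (Fin)
import Data.Fin as Fin
open import Data.Fin.Properties using (any?)
open import Data.Fin.Subset using (Subset; _∈_; _∉_; _⊆_; _⊃_; _∪_; ⁅_⁆; inside; outside)
open import Data.Fin.Subset.Properties using (_∈?_; _⊆?_; p⊆p∪q; x∈p∪q⁺; x∈p∪q⁻; x∈⁅x⁆; x∈⁅y⁆⇒x≡y)
open import Data.Fin.Subset.Induction using (Acc; acc; ⊃-wellFounded)
open import Data.Product using (Σ-syntax; ∃; ∃₂; _×_; _,_; proj₁; proj₂; curry; uncurry)
import Data.Product as Product
open import Data.Product.Properties using (≡-dec)
open import Data.Vec using ([]; _∷_)
import Data.Vec.Properties as Vec
open import Data.Sum using (inj₁; inj₂)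
open import Data.Empty using (⊥-elim)
open import Data.List using (List; []; _∷_; _++_; map; concatMap; initLast; _∷ʳ′_)
open import Data.List.NonEmpty using (List⁺; _∷⁺_; head; last; toList) renaming (_∷_ to _∷₁_)
open import Data.List.Relation.Unary.Any using (here; there)
import Data.List.Relation.Unary.Any as Any
open import Data.List.Relation.Unary.All using (All; []; _∷_; universal)
import Data.List.Relation.Unary.All as All
open import Data.List.Relation.Unary.All.Properties using (¬Any⇒All¬; All¬⇒¬Any; concat⁺; map⁺) renaming (++⁺ to All-++⁺)
open import Data.List.Membership.Propositional using () renaming (_∈_ to _∈ₗ_)
open import Data.List.Membership.Propositional.Properties using (∈-map⁺; ∈-concat⁺′; ∈-++⁺ˡ; ∈-++⁺ʳ)
open import Relation.Binary using (Rel; Decidable; DecidableEquality)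
open import Relation.Binary.Construct.Closure.ReflexiveTransitive using (Star; ε; _◅_; _◅◅_)
open import Relation.Nullary.Decidable using (_×-dec_; _⊎-dec_; ¬?; decidable-stable; map′)
open import Relation.Binary.PropositionalEquality using (_≡_; refl; sym; trans; subst; cong₂)

-- 1. Reachability in a finite graph is decidable

module Reachability {n : ℕ} {E : Rel (Fin n) 0ℓ} (E? : Decidable E) where

  Closed : Subset n → Set
  Closed S = ∀ {u v} → u ∈ S → E u v → v ∈ S

  closed-reach : ∀ {S u v} → Closed S → u ∈ S → Star E u v → v ∈ S
  closed-reach closed u∈S ε        = u∈S
  closed-reach closed u∈S (e ◅ es) = closed-reach closed (closed u∈S e) es

  Frontier : Subset n → Fin n → Set
  Frontier S v = v ∉ S × ∃ λ u → u ∈ S × E u v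

  frontier? : ∀ S → Dec (∃ (Frontier S))
  frontier? S = any? λ v → ¬? (v ∈? S) ×-dec any? λ u → (u ∈? S) ×-dec E? u v

  -- Every set S of vertices reachable from p extends to a closed set of
  -- vertices reachable from p: add frontier vertices one at a time.  Each
  -- addition strictly enlarges S, so the recursion is well founded.
  saturate : ∀ {p} S → Acc _⊃_ S → (∀ {v} → v ∈ S → Star E p v) →
             Σ[ R ∈ Subset n ] S ⊆ R × Closed R × (∀ {v} → v ∈ R → Star E p v)
  saturate S _ reach with frontier? S
  saturate S _ reach | no noFrontier = S , id , closed , reach
    where
      closed : Closed S
      closed {v = v} u∈S e =
        decidable-stable (v ∈? S) (λ v∉S → noFrontier (v , v∉S , _ , u∈S , e))
  saturate {p} S (acc larger) reach | yes (v , v∉S , u , u∈S , e)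
    with saturate (S ∪ ⁅ v ⁆) (larger S⊂S′) reach′
    where
      S⊂S′ : (S ∪ ⁅ v ⁆) ⊃ S
      S⊂S′ = p⊆p∪q ⁅ v ⁆ , v , x∈p∪q⁺ (inj₂ (x∈⁅x⁆ v)) , v∉S

      reach′ : ∀ {w} → w ∈ S ∪ ⁅ v ⁆ → Star E p w
      reach′ {w} w∈S′ with x∈p∪q⁻ S ⁅ v ⁆ w∈S′
      ... | inj₁ w∈S = reach w∈S
      ... | inj₂ w∈⁅v⁆ rewrite x∈⁅y⁆⇒x≡y v w∈⁅v⁆ = reach u∈S ◅◅ (e ◅ ε)
  ... | R , S′⊆R , closed , reachR = R , S′⊆R ∘ p⊆p∪q ⁅ v ⁆ , closed , reachR

  -- Saturating {p} gives exactly the vertices reachable from p.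
  reachable? : Decidable (Star E)
  reachable? p q with saturate ⁅ p ⁆ (⊃-wellFounded ⁅ p ⁆) start
    where
      start : ∀ {v} → v ∈ ⁅ p ⁆ → Star E p v
      start v∈⁅p⁆ rewrite x∈⁅y⁆⇒x≡y p v∈⁅p⁆ = ε
  ... | R , ⁅p⁆⊆R , closed , reachR with q ∈? R
  ...   | yes q∈R = yes (reachR q∈R)
  ...   | no  q∉R = no (q∉R ∘ closed-reach closed (⁅p⁆⊆R (x∈⁅x⁆ p)))

-- 2. Gateways are decidable

last-∷⁺ : ∀ {A : Set} (x : A) (xs : List⁺ A) → last (x ∷⁺ xs) ≡ last xs
last-∷⁺ x (y ∷₁ ys) with initLast ys
... | []      = refl
... | _ ∷ʳ′ _ = refl

all-last : ∀ {A : Set} {P : A → Set} (xs : List⁺ A) → All P (toList xs) → P (last xs)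
all-last (x ∷₁ [])             (px ∷ []) = px
all-last {P = P} (x ∷₁ y ∷ ys) (_ ∷ pys) = subst P (sym (last-∷⁺ x (y ∷₁ ys))) (all-last (y ∷₁ ys) pys)

module _ (N : Network) where

  private
    Channel = Fin (channels N)
    Party   = Fin (parties N)

  Link-sym : ∀ {c u v} → Link N c u v → Link N c v u
  Link-sym (inj₁ e) = inj₂ e
  Link-sym (inj₂ e) = inj₁ e

  Link? : ∀ c u v → Dec (Link N c u v)
  Link? c u v = ends N c ≟ (u , v) ⊎-dec ends N c ≟ (v , u)
    where _≟_ = ≡-dec Fin._≟_ Fin._≟_

  Incident : Channel → Party → Set
  Incident c v = ∃ λ u → Link N c v u

  Incident? : ∀ c v → Dec (Incident c v)
  Incident? c v = any? (Link? c v)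

  Step : ChSet N → Rel Party 0ℓ
  Step G u v = ∃ λ c → c ∉ G × Link N c u v

  Step? : ∀ G → Decidable (Step G)
  Step? G u v = any? λ c → ¬? (c ∈? G) ×-dec Link? c u v

  Leak : ChSet N → ChSet N → ChSet N → Set
  Leak G A B = ∃₂ λ a b → (a ∈ A × a ∉ G) × (b ∈ B × b ∉ G) ×
               ∃₂ λ p q → Incident a p × Incident b q × Star (Step G) p q

  leak? : ∀ G A B → Dec (Leak G A B)
  leak? G A B =
    any? λ a → any? λ b → ((a ∈? A) ×-dec ¬? (a ∈? G)) ×-dec ((b ∈? B) ×-dec ¬? (b ∈? G)) ×-dec
    any? λ p → any? λ q → Incident? a p ×-dec Incident? b q ×-dec Reachability.reachable? (Step? G) p q

  walk-head : ∀ {u w cs} → Walk N u w cs → Incident (head cs) u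
  walk-head (one l)    = _ , l
  walk-head (cons l _) = _ , l

  walk-last : ∀ {u w cs} → Walk N u w cs → Incident (last cs) w
  walk-last (one l) = _ , Link-sym l
  walk-last (cons {c = c} {cs = cs} _ walk) = subst (λ d → Incident d _) (sym (last-∷⁺ c cs)) (walk-last walk)

  walk-avoiding : ∀ {G u w cs} → Walk N u w cs → All (_∉ G) (toList cs) → Star (Step G) u w
  walk-avoiding (one l) (c∉G ∷ [])                       = (_ , c∉G , l) ◅ ε
  walk-avoiding (cons {cs = _ ∷₁ _} l walk) (c∉G ∷ avoid) = (_ , c∉G , l) ◅ walk-avoiding walk avoid

  connect : ∀ {G a b x p q y} → a ∉ G → Link N a x p → Star (Step G) p q → b ∉ G → Link N b q y →
            Σ[ cs ∈ List⁺ Channel ] Walk N x y cs × head cs ≡ a × last cs ≡ b × All (_∉ G) (toList cs)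
  connect {a = a} {b} a∉G la ε b∉G lb = a ∷₁ b ∷ [] , cons la (one lb) , refl , refl , a∉G ∷ b∉G ∷ []
  connect {a = a} a∉G la ((c , c∉G , lc) ◅ steps) b∉G lb
    with connect c∉G lc steps b∉G lb
  ... | cs@(_ ∷₁ _) , walk , refl , last≡b , avoid =
        a ∷⁺ cs , cons la walk , refl , trans (last-∷⁺ a cs) last≡b , a∉G ∷ avoid

  gateway⇒¬leak : ∀ {G A B} → Gateway N G A B → ¬ Leak G A B
  gateway⇒¬leak isGateway (a , b , (a∈A , a∉G) , (b∈B , b∉G) , p , q , (_ , lp) , (_ , lq) , steps)
    with connect a∉G (Link-sym lp) steps b∉G lq
  ... | cs , walk , refl , refl , avoid = All¬⇒¬Any avoid (isGateway cs walk a∈A b∈B)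

  avoiding-walk⇒leak : ∀ {G A B u w cs} → Walk N u w cs → head cs ∈ A → last cs ∈ B →
                       All (_∉ G) (toList cs) → Leak G A B
  avoiding-walk⇒leak {cs = cs} walk head∈A last∈B avoid =
    head cs , last cs , (head∈A , All.head avoid) , (last∈B , all-last cs avoid) ,
    _ , _ , walk-head walk , walk-last walk , walk-avoiding walk avoid

  ¬leak⇒gateway : ∀ {G A B} → ¬ Leak G A B → Gateway N G A B
  ¬leak⇒gateway {G} noLeak cs walk head∈A last∈B with Any.any? (_∈? G) (toList cs)
  ... | yes hit  = hit
  ... | no  miss = ⊥-elim (noLeak (avoiding-walk⇒leak walk head∈A last∈B (¬Any⇒All¬ (toList cs) miss)))

  gateway? : ∀ G A B → Dec (Gateway N G A B)
  gateway? G A B = map′ ¬leak⇒gateway gateway⇒¬leak (¬? (leak? G A B))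

-- 3. Propositional tautologies are decidable

-- A property of Boolean functions on X that only depends on their values at
-- finitely many points can be decided for all functions at once, by
-- splitting on the value at each of these points.
module FiniteSupport {X : Set} (_≟_ : DecidableEquality X) where

  _≈[_]_ : (X → Bool) → List X → (X → Bool) → Set
  f ≈[ L ] g = ∀ {x} → x ∈ₗ L → f x ≡ g x

  DependsOn : List X → ((X → Bool) → Set) → Set
  DependsOn L P = ∀ {f g} → f ≈[ L ] g → P f → P g

  _[_≔_] : (X → Bool) → X → Bool → X → Bool
  (f [ x ≔ b ]) y = if does (y ≟ x) then b else f y

  update-cong : ∀ {L f g} x b → f ≈[ L ] g → (f [ x ≔ b ]) ≈[ x ∷ L ] (g [ x ≔ b ])
  update-cong x b f≈g {y} y∈x∷L with y ≟ x | y∈x∷L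
  ... | yes _   | _          = refl
  ... | no  y≢x | here y≡x   = ⊥-elim (y≢x y≡x)
  ... | no  _   | there y∈L = f≈g y∈L

  update-self : ∀ {L} f x → (f [ x ≔ f x ]) ≈[ L ] f
  update-self f x {y} _ with y ≟ x
  ... | yes refl = refl
  ... | no  _    = refl

  -- Deciding P for all f: for L = x ∷ L′, P f holds for all f iff both
  -- overwritten versions f [ x ≔ true ], f [ x ≔ false ] satisfy P for all f,
  -- and that property only depends on L′.
  ∀? : ∀ L (P : (X → Bool) → Set) → DependsOn L P → (∀ f → Dec (P f)) → Dec (∀ f → P f)
  ∀? [] P resp P? = map′ (λ p f → resp (λ ()) p) (λ all → all _) (P? (λ _ → false))
  ∀? (x ∷ L) P resp P? =
    map′ (λ both f → resp (update-self f x) (choose f (f x) (both f))) (λ all f → all _ , all _)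
         (∀? L Both (λ f≈g → Product.map (resp (update-cong x true f≈g)) (resp (update-cong x false f≈g)))
                    (λ f → P? (f [ x ≔ true ]) ×-dec P? (f [ x ≔ false ])))
    where
      Both : (X → Bool) → Set
      Both f = P (f [ x ≔ true ]) × P (f [ x ≔ false ])

      choose : ∀ f b → Both f → P (f [ x ≔ b ])
      choose f true  = proj₁
      choose f false = proj₂

module _ {N : Network} where

  -- Atoms A ▷ B are determined by the pair (A , B); a valuation is a
  -- Boolean function on such pairs (in uncurried form).
  Atom : Set
  Atom = ChSet N × ChSet N

  _≟-atom_ : DecidableEquality Atom
  _≟-atom_ = ≡-dec (Vec.≡-dec Bool._≟_) (Vec.≡-dec Bool._≟_)

  open FiniteSupport _≟-atom_

  atoms : Formula N → List Atom
  atoms (A ▷ B) = (A , B) ∷ []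
  atoms ⊥′      = []
  atoms (φ ⇒ ψ) = atoms φ ++ atoms ψ

  eval-cong : ∀ φ {f g} → f ≈[ atoms φ ] g → eval (curry f) φ ≡ eval (curry g) φ
  eval-cong (A ▷ B) f≈g = f≈g (here refl)
  eval-cong ⊥′      f≈g = refl
  eval-cong (φ ⇒ ψ) f≈g =
    cong₂ (λ a b → not a ∨ b) (eval-cong φ (f≈g ∘ ∈-++⁺ˡ)) (eval-cong ψ (f≈g ∘ ∈-++⁺ʳ (atoms φ)))

  tautology? : (φ : Formula N) → Dec (Tautology φ)
  tautology? φ =
    map′ (λ t val → t (uncurry val)) (λ t f → t (curry f))
         (∀? (atoms φ) (λ f → eval (curry f) φ ≡ true)
             (λ f≈g → trans (sym (eval-cong φ f≈g)))
             (λ f → eval (curry f) φ Bool.≟ true))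

-- 4. Derivability reduces to a tautology

subsets : ∀ n → List (Subset n)
subsets zero    = [] ∷ []
subsets (suc n) = map (inside ∷_) (subsets n) ++ map (outside ∷_) (subsets n)

∈-subsets : ∀ {n} (s : Subset n) → s ∈ₗ subsets n
∈-subsets []                    = here refl
∈-subsets (inside ∷ s)          = ∈-++⁺ˡ (∈-map⁺ (inside ∷_) (∈-subsets s))
∈-subsets {suc n} (outside ∷ s) = ∈-++⁺ʳ (map (inside ∷_) (subsets n)) (∈-map⁺ (outside ∷_) (∈-subsets s))

∈-concatMap⁺ : ∀ {A B : Set} {f : A → List B} {x y xs} → x ∈ₗ xs → y ∈ₗ f x → y ∈ₗ concatMap f xs
∈-concatMap⁺ {f = f} x∈xs y∈fx = ∈-concat⁺′ y∈fx (∈-map⁺ f x∈xs)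

All-concatMap⁺ : ∀ {A B : Set} {P : B → Set} {f : A → List B} →
                 (∀ x → All P (f x)) → ∀ xs → All P (concatMap f xs)
All-concatMap⁺ all-f xs = concat⁺ (map⁺ (universal all-f xs))

when : ∀ {P X : Set} → Dec P → X → List X
when (yes _) x = x ∷ []
when (no  _) _ = []

∈-when : ∀ {P X : Set} {x : X} (p? : Dec P) → P → x ∈ₗ when p? x
∈-when (yes _) _ = here refl
∈-when (no ¬p) p = ⊥-elim (¬p p)

All-when : ∀ {P X : Set} {Q : X → Set} {x : X} (p? : Dec P) → (P → Q x) → All Q (when p? x)
All-when (yes p) q = q p ∷ []
All-when (no  _) _ = []

infixr 5 _⇒*_
_⇒*_ : ∀ {N} → List (Formula N) → Formula N → Formula N
[]       ⇒* φ = φ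
(γ ∷ Γ) ⇒* φ = γ ⇒ Γ ⇒* φ

module _ (N : Network) where

  -- The axiom instances with parameters A, B, C (C plays the gateway in
  -- the gateway scheme).
  instances : ChSet N → ChSet N → ChSet N → List (Formula N)
  instances A B C =
    (A ▷ B ⇒ (A ∪ C) ▷ (B ∪ C)) ∷ (A ▷ B ⇒ (B ▷ C ⇒ A ▷ C)) ∷
    when (B ⊆? A) (A ▷ B) ++ when (gateway? N C A B) (A ▷ B ⇒ C ▷ B)

  instances-derivable : ∀ A B C → All (N ⊢_) (instances A B C)
  instances-derivable A B C =
    augmentation ∷ transitivity ∷ All-++⁺ (All-when (B ⊆? A) reflexivity) (All-when (gateway? N C A B) gateway)

  channel-sets : List (ChSet N)
  channel-sets = subsets (channels N)

  axioms : List (Formula N)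
  axioms = concatMap (λ A → concatMap (λ B → concatMap (instances A B) channel-sets) channel-sets) channel-sets

  instance∈axioms : ∀ A B C {γ} → γ ∈ₗ instances A B C → γ ∈ₗ axioms
  instance∈axioms A B C γ∈ =
    ∈-concatMap⁺ (∈-subsets A) (∈-concatMap⁺ (∈-subsets B) (∈-concatMap⁺ (∈-subsets C) γ∈))

  axioms-derivable : All (N ⊢_) axioms
  axioms-derivable =
    All-concatMap⁺ (λ A → All-concatMap⁺ (λ B → All-concatMap⁺ (instances-derivable A B)
      channel-sets) channel-sets) channel-sets

  sound : ∀ {φ val} → N ⊢ φ → All (λ γ → eval val γ ≡ true) axioms → eval val φ ≡ true
  sound (taut t) _ = t _
  sound (mp d₁ d₂) model = modus-ponens (sound d₁ model) (sound d₂ model)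
    where
      modus-ponens : ∀ {a b} → not a ∨ b ≡ true → a ≡ true → b ≡ true
      modus-ponens b≡true refl = b≡true
  sound (reflexivity {A} {B} B⊆A) model =
    All.lookup model (instance∈axioms A B A (there (there (∈-++⁺ˡ (∈-when (B ⊆? A) B⊆A)))))
  sound (augmentation {A} {B} {C}) model = All.lookup model (instance∈axioms A B C (here refl))
  sound (transitivity {A} {B} {C}) model = All.lookup model (instance∈axioms A B C (there (here refl)))
  sound (gateway {A} {B} {G} isGateway) model =
    All.lookup model (instance∈axioms A B G (there (there
      (∈-++⁺ʳ (when (B ⊆? A) (A ▷ B)) (∈-when (gateway? N G A B) isGateway)))))

  ⇒*-elim : ∀ {Γ φ} → All (N ⊢_) Γ → N ⊢ Γ ⇒* φ → N ⊢ φ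
  ⇒*-elim []        d = d
  ⇒*-elim (dγ ∷ dΓ) d = ⇒*-elim dΓ (mp d dγ)

  ⇒*-true : ∀ {val : ChSet N → ChSet N → Bool} (Γ : List (Formula N)) {φ} →
            (All (λ γ → eval val γ ≡ true) Γ → eval val φ ≡ true) → eval val (Γ ⇒* φ) ≡ true
  ⇒*-true       []      h = h []
  ⇒*-true {val} (γ ∷ Γ) h with eval val γ in γ≡
  ... | true  = ⇒*-true Γ (λ Γ-true → h (γ≡ ∷ Γ-true))
  ... | false = refl

  tautology⇒derivable : ∀ {φ} → Tautology (axioms ⇒* φ) → N ⊢ φ
  tautology⇒derivable t = ⇒*-elim axioms-derivable (taut t)

  derivable⇒tautology : ∀ {φ} → N ⊢ φ → Tautology (axioms ⇒* φ)
  derivable⇒tautology d val = ⇒*-true axioms (sound d)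

corollary1 : (N : Network) (φ : Formula N) → Dec (N ⊢ φ)
corollary1 N φ = map′ (tautology⇒derivable N) (derivable⇒tautology N) (tautology? (axioms N ⇒* φ))
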